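{- Let $\mathcal{A}$ be the set of all Arndt compositions (of all weights $n\ge0$), and for $\sigma\in\mathcal{A}$ let $\mathrm{last}(\sigma)$ be its last part (with $\mathrm{last}=0$ for the empty composition). Then $$\sum_{\sigma\in\mathcal{A}}x^{|\sigma|}y^{\mathrm{last}(\sigma)}=\frac{1 - x - x^2 - x^2 y + 2 x^3 y + 2 x^4 y - x^5 y - x^4 y^2}{ (1 - x - x^2) (1 - x y) (1 - x^2 y)}.$$
   Context: A composition of $n\ge0$ is a finite sequence $\sigma=(\sigma_1,\dots,\sigma_\ell)$ of positive integers summing to $n=|\sigma|$ (the empty composition is the composition of $0$). An Arndt composition is one with $\sigma_{2i-1}>\sigma_{2i}$ for every positive integer $i$ with $2i\le\ell$. -}

module Defs where

open import Data.Nat as ℕ using (ℕ; zero; suc; _<_; _≟_)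
open import Data.Nat.Properties using (_<?_)
open import Data.Integer as ℤ using (ℤ; +_)
open import Data.Nat.ListAction using (sum)
open import Data.List using (List; []; _∷_; length; filter; map; concatMap)
open import Data.Product using (_×_)
open import Data.Unit using (⊤)
open import Relation.Nullary using (Dec; yes; no)
open import Relation.Nullary.Decidable using (_×-dec_)
open import Relation.Binary.PropositionalEquality using (_≡_)

range : ℕ → ℕ → List ℕ
range a zero    = a ∷ []
range a (suc k) = a ∷ range (suc a) k

oneTo : ℕ → List ℕ
oneTo zero    = []
oneTo (suc n) = range 1 n

tuples : ℕ → ℕ → List (List ℕ)
tuples zero    n = [] ∷ []
tuples (suc ℓ) n = concatMap (λ k → map (k ∷_) (tuples ℓ n)) (oneTo n)

candidates : ℕ → List (List ℕ)
candidates n = concatMap (λ ℓ → tuples ℓ n) (range 0 n)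

-- the compositions of n: finite sequences of positive integers summing to n
-- (each appears exactly once: a composition of n has length ≤ n and parts ≤ n)
compositions : ℕ → List (List ℕ)
compositions n = filter (λ σ → sum σ ≟ n) (candidates n)

Arndt : List ℕ → Set
Arndt []            = ⊤
Arndt (a ∷ [])      = ⊤
Arndt (a ∷ b ∷ σ)   = (b < a) × Arndt σ

arndt? : (σ : List ℕ) → Dec (Arndt σ)
arndt? []          = yes _
arndt? (a ∷ [])    = yes _
arndt? (a ∷ b ∷ σ) = (b <? a) ×-dec arndt? σ

lastPart : List ℕ → ℕ
lastPart []          = 0
lastPart (a ∷ [])    = a
lastPart (a ∷ b ∷ σ) = lastPart (b ∷ σ)

arndtCount : ℕ → ℕ → ℕ
arndtCount n m =
  length (filter (λ σ → arndt? σ ×-dec (lastPart σ ≟ m)) (compositions n))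

-- Formal power series in x, y over ℤ: coefficient of x^n y^m

Series : Set
Series = ℕ → ℕ → ℤ

sumTo : ℕ → (ℕ → ℤ) → ℤ
sumTo zero    f = f 0
sumTo (suc n) f = sumTo n f ℤ.+ f (suc n)

const : ℤ → Series
const c zero zero = c
const c _    _    = + 0

X : Series
X 1 0 = + 1
X _ _ = + 0

Y : Series
Y 0 1 = + 1
Y _ _ = + 0

infixl 6 _⊕_ _⊖_
infixl 7 _⊛_
infixr 8 _^ˢ_

_⊕_ : Series → Series → Series
(f ⊕ g) n m = f n m ℤ.+ g n m

_⊖_ : Series → Series → Series
(f ⊖ g) n m = f n m ℤ.- g n m

_⊛_ : Series → Series → Series
(f ⊛ g) n m = sumTo n (λ i → sumTo m (λ j → f i j ℤ.* g (n ℕ.∸ i) (m ℕ.∸ j)))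

_^ˢ_ : Series → ℕ → Series
f ^ˢ zero  = const (+ 1)
f ^ˢ suc k = f ⊛ f ^ˢ k

arndtGF : Series
arndtGF n m = + arndtCount n m

numerator : Series
numerator =
  const (+ 1) ⊖ X ⊖ X ^ˢ 2 ⊖ X ^ˢ 2 ⊛ Y ⊕ const (+ 2) ⊛ X ^ˢ 3 ⊛ Y
  ⊕ const (+ 2) ⊛ X ^ˢ 4 ⊛ Y ⊖ X ^ˢ 5 ⊛ Y ⊖ X ^ˢ 4 ⊛ Y ^ˢ 2

denominator : Series
denominator =
  (const (+ 1) ⊖ X ⊖ X ^ˢ 2) ⊛ (const (+ 1) ⊖ X ⊛ Y) ⊛ (const (+ 1) ⊖ X ^ˢ 2 ⊛ Y)

-- Cutting an Arndt composition after every second part writes it as a sequence of pairs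
-- a > b ≥ 1 followed by a tail of length 0, 1 or 2 that carries the last part. The pairs have
-- generating function x³ / ((1 - x)(1 - x²)), so the column b of compositions with last part
-- m ≥ 1 satisfies b = β + x³ b / ((1 - x)(1 - x²)), where β = x^m + x^(2m+1) / (1 - x) counts
-- the tails (m) and (a, m); that is, (1 - x - x²) b = (1 - x)(1 - x²) β. Hence (1 - x - x²) A
-- is explicit, and its two parts are invariant under the shifts (n, m) ↦ (n + 1, m + 1) and
-- (n + 2, m + 1), which 1 - xy and 1 - x²y annihilate. What is left lives in the columns
-- m ≤ 2 and is compared with the numerator by evaluation.

module Submission where

open import Defs
open import Function using (_∘_)
open import Data.Bool using (Bool; true; false; _∧_; T; if_then_else_)
import Data.Bool.Properties as Bool
open import Data.Empty using (⊥-elim)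
open import Data.List using (List; []; _∷_; _++_; map; concatMap; filter; length)
open import Data.Nat as ℕ using (ℕ; zero; suc; _+_; _∸_; _≤_; _<_; z≤n; s≤s; _≡ᵇ_; _<ᵇ_; _≤ᵇ_)
import Data.Nat.Properties as ℕₚ
open import Data.Nat.ListAction using (sum)
import Data.Nat.Tactic.RingSolver as ℕ-Solver
open import Data.Product using (_×_; _,_; proj₁)
open import Relation.Nullary using (does; yes; no)
open import Relation.Unary using (Decidable)
open import Relation.Binary.PropositionalEquality
open ≡-Reasoning

iverson : Bool → ℕ
iverson b = if b then 1 else 0

if-cong : ∀ b {x y : ℕ} → (T b → x ≡ y) → (if b then x else 0) ≡ (if b then y else 0)
if-cong true  eq = eq _
if-cong false eq = refl

if-+ : ∀ b x y → (if b then x + y else 0) ≡ (if b then x else 0) + (if b then y else 0)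
if-+ true  x y = refl
if-+ false x y = refl

≤ᵇ-false : ∀ a n → n < a → (a ≤ᵇ n) ≡ false
≤ᵇ-false a n n<a with a ≤ᵇ n in eq
... | false = refl
... | true  = ⊥-elim (ℕₚ.<⇒≱ n<a (ℕₚ.≤ᵇ⇒≤ a n (subst T (sym eq) _)))

if-0 : ∀ b → (if b then 0 else 0) ≡ 0
if-0 true  = refl
if-0 false = refl

if-∧-≤ᵇ-false : ∀ b a n x → n < a → (if b ∧ (a ≤ᵇ n) then x else 0) ≡ 0
if-∧-≤ᵇ-false b a n x n<a rewrite ≤ᵇ-false a n n<a | Bool.∧-zeroʳ b = refl

if-≤ᵇ-false : ∀ a n x → n < a → (if a ≤ᵇ n then x else 0) ≡ 0
if-≤ᵇ-false a n x n<a rewrite ≤ᵇ-false a n n<a = refl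


count : {A : Set} → (A → Bool) → List A → ℕ
count p []       = 0
count p (x ∷ xs) = iverson (p x) + count p xs

module _ {A : Set} where

  count-cong : ∀ {p q : A → Bool} → (∀ x → p x ≡ q x) → ∀ xs → count p xs ≡ count q xs
  count-cong eq []       = refl
  count-cong eq (x ∷ xs) = cong₂ _+_ (cong iverson (eq x)) (count-cong eq xs)

  count-++ : ∀ (p : A → Bool) xs ys → count p (xs ++ ys) ≡ count p xs + count p ys
  count-++ p []       ys = refl
  count-++ p (x ∷ xs) ys =
    trans (cong (iverson (p x) +_) (count-++ p xs ys)) (sym (ℕₚ.+-assoc (iverson (p x)) _ _))

  count-map : ∀ {B : Set} (p : B → Bool) (f : A → B) xs → count p (map f xs) ≡ count (p ∘ f) xs
  count-map p f []       = refl
  count-map p f (x ∷ xs) = cong (iverson (p (f x)) +_) (count-map p f xs)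

  count-∧ : ∀ b (p : A → Bool) xs → count (λ x → b ∧ p x) xs ≡ (if b then count p xs else 0)
  count-∧ true  p xs       = refl
  count-∧ false p []       = refl
  count-∧ false p (x ∷ xs) = count-∧ false p xs

  length-filter : ∀ {P : A → Set} (P? : Decidable P) xs → length (filter P? xs) ≡ count (does ∘ P?) xs
  length-filter P? []       = refl
  length-filter P? (x ∷ xs) with does (P? x)
  ... | true  = cong suc (length-filter P? xs)
  ... | false = length-filter P? xs

  count-filter : ∀ {P : A → Set} (P? : Decidable P) (q : A → Bool) xs →
                 count q (filter P? xs) ≡ count (λ x → does (P? x) ∧ q x) xs
  count-filter P? q []       = refl
  count-filter P? q (x ∷ xs) with does (P? x)
  ... | true  = cong (iverson (q x) +_) (count-filter P? q xs)
  ... | false = count-filter P? q xs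

sumBelow : ℕ → (ℕ → ℕ) → ℕ
sumBelow zero    f = 0
sumBelow (suc M) f = f 0 + sumBelow M (f ∘ suc)

sumBelow-cong : ∀ M {f g : ℕ → ℕ} → (∀ i → i < M → f i ≡ g i) → sumBelow M f ≡ sumBelow M g
sumBelow-cong zero    eq = refl
sumBelow-cong (suc M) eq = cong₂ _+_ (eq 0 (s≤s z≤n)) (sumBelow-cong M λ i i<M → eq (suc i) (s≤s i<M))

sumBelow-zero : ∀ M {f : ℕ → ℕ} → (∀ i → i < M → f i ≡ 0) → sumBelow M f ≡ 0
sumBelow-zero zero    eq = refl
sumBelow-zero (suc M) eq = cong₂ _+_ (eq 0 (s≤s z≤n)) (sumBelow-zero M λ i i<M → eq (suc i) (s≤s i<M))

sumBelow-+ : ∀ M (f g : ℕ → ℕ) → sumBelow M (λ i → f i + g i) ≡ sumBelow M f + sumBelow M g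
sumBelow-+ zero    f g = refl
sumBelow-+ (suc M) f g = begin
  f 0 + g 0 + sumBelow M (λ i → f (suc i) + g (suc i))
    ≡⟨ cong (f 0 + g 0 +_) (sumBelow-+ M (f ∘ suc) (g ∘ suc)) ⟩
  f 0 + g 0 + (sumBelow M (f ∘ suc) + sumBelow M (g ∘ suc))
    ≡⟨ interchange (f 0) (g 0) _ _ ⟩
  f 0 + sumBelow M (f ∘ suc) + (g 0 + sumBelow M (g ∘ suc)) ∎
  where
  interchange : ∀ a b c d → a + b + (c + d) ≡ a + c + (b + d)
  interchange = ℕ-Solver.solve-∀

sumBelow-if : ∀ M b (f : ℕ → ℕ) → sumBelow M (λ i → if b then f i else 0) ≡ (if b then sumBelow M f else 0)
sumBelow-if M true  f = refl
sumBelow-if M false f = sumBelow-zero M λ _ _ → refl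

sumBelow-swap : ∀ M L (f : ℕ → ℕ → ℕ) →
                sumBelow M (λ i → sumBelow L (f i)) ≡ sumBelow L (λ j → sumBelow M (λ i → f i j))
sumBelow-swap zero    L f = sym (sumBelow-zero L λ _ _ → refl)
sumBelow-swap (suc M) L f =
  trans (cong (sumBelow L (f 0) +_) (sumBelow-swap M L (f ∘ suc))) (sym (sumBelow-+ L (f 0) _))

sumBelow-snoc : ∀ M (f : ℕ → ℕ) → sumBelow (suc M) f ≡ sumBelow M f + f M
sumBelow-snoc zero    f = ℕₚ.+-comm (f 0) 0
sumBelow-snoc (suc M) f =
  trans (cong (f 0 +_) (sumBelow-snoc M (f ∘ suc))) (sym (ℕₚ.+-assoc (f 0) _ _))

sumBelow-extend : ∀ M K (f : ℕ → ℕ) → M ≤ K → (∀ i → M ≤ i → f i ≡ 0) → sumBelow K f ≡ sumBelow M f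
sumBelow-extend M K f M≤K eq = go (ℕₚ.≤⇒≤′ M≤K)
  where
  go : ∀ {K} → M ℕ.≤′ K → sumBelow K f ≡ sumBelow M f
  go ℕ.≤′-refl            = refl
  go (ℕ.≤′-step {K} M≤′K) = begin
    sumBelow (suc K) f     ≡⟨ sumBelow-snoc K f ⟩
    sumBelow K f + f K     ≡⟨ cong₂ _+_ (go M≤′K) (eq K (ℕₚ.≤′⇒≤ M≤′K)) ⟩
    sumBelow M f + 0       ≡⟨ ℕₚ.+-identityʳ _ ⟩
    sumBelow M f           ∎

count-concatMap-range : ∀ {A : Set} (p : A → Bool) (F : ℕ → List A) a k →
  count p (concatMap F (range a k)) ≡ sumBelow (suc k) (λ i → count p (F (a + i)))
count-concatMap-range p F a zero = begin
  count p (F a ++ [])          ≡⟨ count-++ p (F a) [] ⟩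
  count p (F a) + 0            ≡⟨ cong (λ b → count p (F b) + 0) (ℕₚ.+-identityʳ a) ⟨
  count p (F (a + 0)) + 0      ∎
count-concatMap-range p F a (suc k) = begin
  count p (F a ++ concatMap F (range (suc a) k))
    ≡⟨ count-++ p (F a) _ ⟩
  count p (F a) + count p (concatMap F (range (suc a) k))
    ≡⟨ cong₂ _+_ (cong (count p ∘ F) (sym (ℕₚ.+-identityʳ a)))
                 (count-concatMap-range p F (suc a) k) ⟩
  count p (F (a + 0)) + sumBelow (suc k) (λ i → count p (F (suc a + i)))
    ≡⟨ cong (count p (F (a + 0)) +_)
         (sumBelow-cong (suc k) λ i _ → cong (count p ∘ F) (sym (ℕₚ.+-suc a i))) ⟩
  count p (F (a + 0)) + sumBelow (suc k) (λ i → count p (F (a + suc i))) ∎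

count-tuples : ∀ (p : List ℕ → Bool) ℓ N →
  count p (tuples (suc ℓ) N) ≡ sumBelow N (λ k → count (λ σ → p (suc k ∷ σ)) (tuples ℓ N))
count-tuples p ℓ zero    = refl
count-tuples p ℓ (suc N) = trans (count-concatMap-range p _ 1 N)
  (sumBelow-cong (suc N) λ k _ → count-map p (suc k ∷_) (tuples ℓ (suc N)))

count-candidates : ∀ (p : List ℕ → Bool) n →
  count p (candidates n) ≡ sumBelow (suc n) (λ ℓ → count p (tuples ℓ n))
count-candidates p n = count-concatMap-range p (λ ℓ → tuples ℓ n) 0 n

-- The sum over the pairs a > b ≥ 1 with a + b ≤ n of φ (n - a - b) (b - 1),
-- with a = k + 1 and b = j + 1 for k, j < M.
pairSum : ℕ → (ℕ → ℕ → ℕ) → ℕ → ℕ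
pairSum M φ n = sumBelow M λ k → sumBelow M λ j →
  if (j <ᵇ k) ∧ (2 + j + k ≤ᵇ n) then φ (n ∸ (2 + j + k)) j else 0

pairSum-cong : ∀ M {φ ψ : ℕ → ℕ → ℕ} n → (∀ t j → 2 + t ≤ n → φ t j ≡ ψ t j) →
               pairSum M φ n ≡ pairSum M ψ n
pairSum-cong M {φ} {ψ} n eq = sumBelow-cong M λ k _ → sumBelow-cong M λ j _ → term (j <ᵇ k) j k
  where
  remainder : ∀ n w → 2 + w ≤ n → 2 + (n ∸ (2 + w)) ≤ n
  remainder (suc zero)    w (s≤s ())
  remainder (suc (suc n)) w _        = s≤s (s≤s (ℕₚ.m∸n≤m n w))
  term : ∀ b j k → (if b ∧ (2 + j + k ≤ᵇ n) then φ (n ∸ (2 + j + k)) j else 0)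
                 ≡ (if b ∧ (2 + j + k ≤ᵇ n) then ψ (n ∸ (2 + j + k)) j else 0)
  term false j k = refl
  term true  j k = if-cong (2 + j + k ≤ᵇ n) λ w≤n →
    eq _ j (remainder n (j + k) (ℕₚ.≤ᵇ⇒≤ (2 + j + k) n w≤n))

pairSum-zero : ∀ M {φ : ℕ → ℕ → ℕ} n → (∀ t j → 2 + t ≤ n → φ t j ≡ 0) → pairSum M φ n ≡ 0
pairSum-zero M n eq = trans (pairSum-cong M n eq)
  (sumBelow-zero M λ k _ → sumBelow-zero M λ j _ → if-0 _)

pairSum-+ : ∀ M (φ ψ : ℕ → ℕ → ℕ) n →
            pairSum M (λ t j → φ t j + ψ t j) n ≡ pairSum M φ n + pairSum M ψ n
pairSum-+ M φ ψ n = trans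
  (sumBelow-cong M λ k _ → trans (sumBelow-cong M λ j _ → if-+ ((j <ᵇ k) ∧ (2 + j + k ≤ᵇ n)) _ _)
                                 (sumBelow-+ M _ _))
  (sumBelow-+ M _ _)

pairSum-sumBelow : ∀ L M (φ : ℕ → ℕ → ℕ → ℕ) n →
  sumBelow L (λ ℓ → pairSum M (φ ℓ) n) ≡ pairSum M (λ t j → sumBelow L (λ ℓ → φ ℓ t j)) n
pairSum-sumBelow L M φ n = trans (sumBelow-swap L M _) (sumBelow-cong M λ k _ →
  trans (sumBelow-swap L M _) (sumBelow-cong M λ j _ → sumBelow-if L _ _))

pairSum-extend : ∀ M K φ n → M ≤ K → n ≤ suc M → pairSum K φ n ≡ pairSum M φ n
pairSum-extend M K φ n M≤K n≤1+M = begin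
  sumBelow K (λ k → sumBelow K (term k))
    ≡⟨ sumBelow-cong K (λ k _ → sumBelow-extend M K (term k) M≤K λ j M≤j →
         if-∧-≤ᵇ-false (j <ᵇ k) (2 + j + k) n _ (tooHeavy j k (ℕₚ.≤-trans M≤j (ℕₚ.m≤m+n j k)))) ⟩
  sumBelow K (λ k → sumBelow M (term k))
    ≡⟨ sumBelow-extend M K _ M≤K (λ k M≤k → sumBelow-zero M λ j _ →
         if-∧-≤ᵇ-false (j <ᵇ k) (2 + j + k) n _ (tooHeavy j k (ℕₚ.≤-trans M≤k (ℕₚ.m≤n+m k j)))) ⟩
  sumBelow M (λ k → sumBelow M (term k)) ∎
  where
  term : ℕ → ℕ → ℕ
  term k j = if (j <ᵇ k) ∧ (2 + j + k ≤ᵇ n) then φ (n ∸ (2 + j + k)) j else 0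
  tooHeavy : ∀ j k → M ≤ j + k → n < 2 + j + k
  tooHeavy j k M≤j+k = ℕₚ.≤-trans (s≤s n≤1+M) (s≤s (s≤s M≤j+k))

-- The terms of pairSum with b = 1, i.e. a = k + 2.
unitPairSum : ℕ → (ℕ → ℕ) → ℕ → ℕ
unitPairSum M ψ n = sumBelow M λ k → if 3 + k ≤ᵇ n then ψ (n ∸ (3 + k)) else 0

unitPairSum-extend : ∀ M K ψ n → M ≤ K → n ≤ 2 + M → unitPairSum K ψ n ≡ unitPairSum M ψ n
unitPairSum-extend M K ψ n M≤K n≤2+M = sumBelow-extend M K _ M≤K λ k M≤k →
  if-≤ᵇ-false (3 + k) n _ (ℕₚ.≤-trans (s≤s n≤2+M) (s≤s (s≤s (s≤s M≤k))))

unitPairSum-small : ∀ M ψ n → n ≤ 2 → unitPairSum M ψ n ≡ 0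
unitPairSum-small M ψ n n≤2 = sumBelow-zero M λ k _ →
  if-≤ᵇ-false (3 + k) n _ (ℕₚ.≤-trans (s≤s n≤2) (s≤s (s≤s (s≤s z≤n))))

pairSum-peel : ∀ M φ n →
  pairSum (suc M) φ (2 + n) ≡ unitPairSum M (λ t → φ t 0) (2 + n) + pairSum M (λ t j → φ t (suc j)) n
pairSum-peel M φ n = begin
  sumBelow (suc M) (term 0) + sumBelow M (λ k → sumBelow (suc M) (term (suc k)))
    ≡⟨ cong (_+ sumBelow M (λ k → sumBelow (suc M) (term (suc k)))) (sumBelow-zero (suc M) λ _ _ → refl) ⟩
  sumBelow M (λ k → term (suc k) 0 + sumBelow M (λ j → term (suc k) (suc j)))
    ≡⟨ sumBelow-cong M (λ k _ → cong (term (suc k) 0 +_) (sumBelow-cong M λ j _ →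
         cong (λ w → if (j <ᵇ k) ∧ (3 + w ≤ᵇ 2 + n) then φ (2 + n ∸ (3 + w)) (suc j) else 0)
              (ℕₚ.+-suc j k))) ⟩
  sumBelow M (λ k → term (suc k) 0 + pairSumTerm k)
    ≡⟨ sumBelow-+ M _ _ ⟩
  unitPairSum M (λ t → φ t 0) (2 + n) + pairSum M (λ t j → φ t (suc j)) n ∎
  where
  term : ℕ → ℕ → ℕ
  term k j = if (j <ᵇ k) ∧ (2 + j + k ≤ᵇ 2 + n) then φ (2 + n ∸ (2 + j + k)) j else 0
  pairSumTerm : ℕ → ℕ
  pairSumTerm k = sumBelow M λ j →
    if (j <ᵇ k) ∧ (2 + j + k ≤ᵇ n) then φ (n ∸ (2 + j + k)) (suc j) else 0

-- The generating function of the pairs a > b ≥ 1 is x³ / ((1 - x)(1 - x²)).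
pairSum-recurrence : ∀ M (ψ : ℕ → ℕ) n → 3 + n ≤ M →
  pairSum M (λ t _ → ψ t) (3 + n) + pairSum M (λ t _ → ψ t) n
    ≡ ψ n + pairSum M (λ t _ → ψ t) (2 + n) + pairSum M (λ t _ → ψ t) (1 + n)
pairSum-recurrence (suc (suc (suc M))) ψ n (s≤s (s≤s (s≤s n≤M))) = begin
  S (3 + n) + S n
    ≡⟨ cong (_+ S n) (trans (pairSum-peel M₂ φ (1 + n)) (cong₂ _+_ unit-step
         (sym (pairSum-extend M₂ M₃ φ (1 + n) (ℕₚ.n≤1+n M₂) (ℕₚ.≤-trans (s≤s n≤M) (ℕₚ.m≤n+m _ 2)))))) ⟩
  ψ n + U (2 + n) + S (1 + n) + S n
    ≡⟨ rearrange (ψ n) (U (2 + n)) (S (1 + n)) (S n) ⟩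
  ψ n + (U (2 + n) + S n) + S (1 + n)
    ≡⟨ cong (λ s → ψ n + s + S (1 + n)) (trans (cong (U (2 + n) +_)
         (pairSum-extend M₂ M₃ φ n (ℕₚ.n≤1+n M₂) (ℕₚ.≤-trans n≤M (ℕₚ.m≤n+m M 3))))
         (sym (pairSum-peel M₂ φ n))) ⟩
  ψ n + S (2 + n) + S (1 + n) ∎
  where
  M₂ M₃ : ℕ
  M₂ = suc (suc M)
  M₃ = suc M₂
  φ : ℕ → ℕ → ℕ
  φ t _ = ψ t
  S U : ℕ → ℕ
  S = pairSum M₃ φ
  U = unitPairSum M₂ ψ
  unit-step : U (3 + n) ≡ ψ n + U (2 + n)
  unit-step = cong (ψ n +_) (sym
    (unitPairSum-extend (suc M) M₂ ψ (2 + n) (ℕₚ.n≤1+n _) (s≤s (s≤s (ℕₚ.m≤n⇒m≤1+n n≤M)))))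
  rearrange : ∀ a b c d → a + b + c + d ≡ a + (b + d) + c
  rearrange = ℕ-Solver.solve-∀

lastOr : ℕ → List ℕ → ℕ
lastOr d []      = d
lastOr d (x ∷ σ) = lastOr x σ

lastPart≡lastOr : ∀ σ → lastPart σ ≡ lastOr 0 σ
lastPart≡lastOr []      = refl
lastPart≡lastOr (x ∷ σ) = go 0 x σ
  where
  go : ∀ d x σ → lastPart (x ∷ σ) ≡ lastOr d (x ∷ σ)
  go d x []      = refl
  go d x (y ∷ σ) = go x y σ

isArndtWith : ℕ → ℕ → ℕ → List ℕ → Bool
isArndtWith n m d σ = (sum σ ≡ᵇ n) ∧ (does (arndt? σ) ∧ (lastOr d σ ≡ᵇ m))

arndtOfLength : ℕ → ℕ → ℕ → ℕ → ℕ → ℕ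
arndtOfLength N zero          n m d = iverson ((d ≡ᵇ m) ∧ (0 ≡ᵇ n))
arndtOfLength N (suc zero)    n m d = sumBelow N λ k → iverson ((suc k ≡ᵇ n) ∧ (suc k ≡ᵇ m))
arndtOfLength N (suc (suc ℓ)) n m d = pairSum N (λ t j → arndtOfLength N ℓ t m (suc j)) n

≡ᵇ-+ : ∀ a s n → (a + s ≡ᵇ n) ≡ (a ≤ᵇ n) ∧ (s ≡ᵇ n ∸ a)
≡ᵇ-+ zero    s n       = refl
≡ᵇ-+ (suc a) s zero    = refl
≡ᵇ-+ (suc a) s (suc n) = trans (≡ᵇ-+ a s n) (cong (_∧ (s ≡ᵇ n ∸ a)) (<ᵇ-suc a n))
  where
  <ᵇ-suc : ∀ a n → (a ≤ᵇ n) ≡ (a <ᵇ suc n)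
  <ᵇ-suc zero    n = refl
  <ᵇ-suc (suc a) n = refl

isArndtWith-pair : ∀ n m d k j σ → isArndtWith n m d (suc k ∷ suc j ∷ σ) ≡
  ((j <ᵇ k) ∧ (2 + j + k ≤ᵇ n)) ∧ isArndtWith (n ∸ (2 + j + k)) m (suc j) σ
isArndtWith-pair n m d k j σ = begin
  (suc k + (suc j + sum σ) ≡ᵇ n) ∧ rest
    ≡⟨ cong (λ w → (w ≡ᵇ n) ∧ rest) (weight k j (sum σ)) ⟩
  (2 + j + k + sum σ ≡ᵇ n) ∧ rest
    ≡⟨ cong (_∧ rest) (≡ᵇ-+ (2 + j + k) (sum σ) n) ⟩
  ((2 + j + k ≤ᵇ n) ∧ (sum σ ≡ᵇ n ∸ (2 + j + k))) ∧ rest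
    ≡⟨ reassociate (2 + j + k ≤ᵇ n) _ (j <ᵇ k) _ _ ⟩
  ((j <ᵇ k) ∧ (2 + j + k ≤ᵇ n)) ∧ isArndtWith (n ∸ (2 + j + k)) m (suc j) σ ∎
  where
  rest : Bool
  rest = ((j <ᵇ k) ∧ does (arndt? σ)) ∧ (lastOr (suc j) σ ≡ᵇ m)
  weight : ∀ k j s → suc k + (suc j + s) ≡ 2 + j + k + s
  weight = ℕ-Solver.solve-∀
  reassociate : ∀ a b c d e → (a ∧ b) ∧ ((c ∧ d) ∧ e) ≡ (c ∧ a) ∧ (b ∧ (d ∧ e))
  reassociate true  b     true  d e = refl
  reassociate true  b     false d e = Bool.∧-zeroʳ b
  reassociate false b     true  d e = refl
  reassociate false b     false d e = refl

count-arndtOfLength : ∀ N ℓ n m d → count (isArndtWith n m d) (tuples ℓ N) ≡ arndtOfLength N ℓ n m d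
count-arndtOfLength N zero n m d = trans (ℕₚ.+-identityʳ _) (cong iverson (Bool.∧-comm (0 ≡ᵇ n) (d ≡ᵇ m)))
count-arndtOfLength N (suc zero) n m d = trans (count-tuples _ 0 N) (sumBelow-cong N λ k _ →
  trans (ℕₚ.+-identityʳ _)
        (cong (λ w → iverson ((w ≡ᵇ n) ∧ (suc k ≡ᵇ m))) (ℕₚ.+-identityʳ (suc k))))
count-arndtOfLength N (suc (suc ℓ)) n m d =
  trans (count-tuples _ (suc ℓ) N) (sumBelow-cong N λ k _ →
  trans (count-tuples _ ℓ N) (sumBelow-cong N λ j _ → begin
    count (λ σ → isArndtWith n m d (suc k ∷ suc j ∷ σ)) (tuples ℓ N)
      ≡⟨ count-cong (isArndtWith-pair n m d k j) (tuples ℓ N) ⟩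
    count (λ σ → guard k j ∧ isArndtWith (n ∸ (2 + j + k)) m (suc j) σ) (tuples ℓ N)
      ≡⟨ count-∧ (guard k j) _ (tuples ℓ N) ⟩
    (if guard k j then count (isArndtWith (n ∸ (2 + j + k)) m (suc j)) (tuples ℓ N) else 0)
      ≡⟨ cong (if guard k j then_else 0) (count-arndtOfLength N ℓ _ m (suc j)) ⟩
    (if guard k j then arndtOfLength N ℓ (n ∸ (2 + j + k)) m (suc j) else 0) ∎))
  where
  guard : ℕ → ℕ → Bool
  guard k j = (j <ᵇ k) ∧ (2 + j + k ≤ᵇ n)

arndtCount≡sumByLength : ∀ n m → arndtCount n m ≡ sumBelow (suc n) (λ ℓ → arndtOfLength n ℓ n m 0)
arndtCount≡sumByLength n m = begin
  arndtCount n m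
    ≡⟨ length-filter _ (filter _ (candidates n)) ⟩
  count _ (filter _ (candidates n))
    ≡⟨ count-filter _ _ (candidates n) ⟩
  count (λ σ → (sum σ ≡ᵇ n) ∧ (does (arndt? σ) ∧ (lastPart σ ≡ᵇ m))) (candidates n)
    ≡⟨ count-cong (λ σ → cong (λ l → (sum σ ≡ᵇ n) ∧ (does (arndt? σ) ∧ (l ≡ᵇ m))) (lastPart≡lastOr σ))
                  (candidates n) ⟩
  count (isArndtWith n m 0) (candidates n)
    ≡⟨ count-candidates _ n ⟩
  sumBelow (suc n) (λ ℓ → count (isArndtWith n m 0) (tuples ℓ n))
    ≡⟨ sumBelow-cong (suc n) (λ ℓ _ → count-arndtOfLength n ℓ n m 0) ⟩
  sumBelow (suc n) (λ ℓ → arndtOfLength n ℓ n m 0) ∎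

arndtOfLength-long : ∀ N ℓ t m d → t < ℓ → arndtOfLength N ℓ t m d ≡ 0
arndtOfLength-long N (suc zero)    zero    m d _              = sumBelow-zero N λ _ _ → refl
arndtOfLength-long N (suc zero)    (suc t) m d (s≤s ())
arndtOfLength-long N (suc (suc ℓ)) t       m d t<2+ℓ = pairSum-zero N t λ t′ j 2+t′≤t →
  arndtOfLength-long N ℓ t′ m (suc j) (ℕₚ.≤-pred (ℕₚ.≤-pred (ℕₚ.≤-trans (s≤s 2+t′≤t) t<2+ℓ)))

arndtOfLength-lastZero : ∀ N ℓ t d → arndtOfLength N (suc ℓ) t 0 d ≡ 0
arndtOfLength-lastZero N zero          t d = sumBelow-zero N λ k _ → cong iverson (Bool.∧-zeroʳ (suc k ≡ᵇ t))
arndtOfLength-lastZero N (suc zero)    t d = pairSum-zero N t λ _ _ _ → refl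
arndtOfLength-lastZero N (suc (suc ℓ)) t d = pairSum-zero N t λ t′ j _ → arndtOfLength-lastZero N ℓ t′ (suc j)

arndtOfLength-default : ∀ N ℓ t m d d′ → arndtOfLength N (suc ℓ) t m d ≡ arndtOfLength N (suc ℓ) t m d′
arndtOfLength-default N zero    t m d d′ = refl
arndtOfLength-default N (suc ℓ) t m d d′ = refl

-- Counted among the compositions with at most N parts, all at most N, as in `candidates`;
-- the bound is immaterial once n ≤ N.
nonemptyArndt : ℕ → ℕ → ℕ → ℕ
nonemptyArndt N m n = sumBelow N (λ ℓ → arndtOfLength N (suc ℓ) n m 0)

nonemptyArndt-zero : ∀ N m → nonemptyArndt N m 0 ≡ 0
nonemptyArndt-zero N m = sumBelow-zero N λ ℓ _ → arndtOfLength-long N (suc ℓ) 0 m 0 (s≤s z≤n)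

-- A composition of length ≥ 2 is a first pair (a, b) followed by either nothing, in which
-- case b is the last part, or a nonempty composition.
nonemptyArndt-firstPair : ∀ N m n → n ≤ N → nonemptyArndt N m n ≡
  arndtOfLength N 1 n m 0 + (pairSum N (λ t j → arndtOfLength N 0 t m (suc j)) n
                             + pairSum N (λ t _ → nonemptyArndt N m t) n)
nonemptyArndt-firstPair zero      m n _   = refl
nonemptyArndt-firstPair (suc N₁) m n n≤N = cong (arndtOfLength (suc N₁) 1 n m 0 +_) (begin
  sumBelow N₁ (λ ℓ → pairSum (suc N₁) (λ t j → arndtOfLength (suc N₁) ℓ t m (suc j)) n)
    ≡⟨ pairSum-sumBelow N₁ (suc N₁) (λ ℓ t j → arndtOfLength (suc N₁) ℓ t m (suc j)) n ⟩
  pairSum (suc N₁) (λ t j → sumBelow N₁ (λ ℓ → arndtOfLength (suc N₁) ℓ t m (suc j))) n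
    ≡⟨ pairSum-cong (suc N₁) {ψ = λ t j → arndtOfLength (suc N₁) 0 t m (suc j) + nonemptyArndt (suc N₁) m t}
                    n (rest N₁ n≤N) ⟩
  pairSum (suc N₁) (λ t j → arndtOfLength (suc N₁) 0 t m (suc j) + nonemptyArndt (suc N₁) m t) n
    ≡⟨ pairSum-+ (suc N₁) (λ t j → arndtOfLength (suc N₁) 0 t m (suc j))
                 (λ t _ → nonemptyArndt (suc N₁) m t) n ⟩
  pairSum (suc N₁) (λ t j → arndtOfLength (suc N₁) 0 t m (suc j)) n
    + pairSum (suc N₁) (λ t _ → nonemptyArndt (suc N₁) m t) n ∎)
  where
  rest : ∀ N₁ → n ≤ suc N₁ → ∀ t j → 2 + t ≤ n →
         sumBelow N₁ (λ ℓ → arndtOfLength (suc N₁) ℓ t m (suc j))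
           ≡ arndtOfLength (suc N₁) 0 t m (suc j) + nonemptyArndt (suc N₁) m t
  rest zero      n≤1   t j 2+t≤n = ⊥-elim (ℕₚ.<⇒≱ (ℕₚ.≤-trans (s≤s (s≤s z≤n)) 2+t≤n) n≤1)
  rest (suc N₂) n≤2+N₂ t j 2+t≤n = cong (arndtOfLength (suc (suc N₂)) 0 t m (suc j) +_) (begin
    sumBelow N₂ (λ ℓ → arndtOfLength (suc (suc N₂)) (suc ℓ) t m (suc j))
      ≡⟨ sumBelow-cong N₂ (λ ℓ _ → arndtOfLength-default _ ℓ t m (suc j) 0) ⟩
    sumBelow N₂ (λ ℓ → arndtOfLength (suc (suc N₂)) (suc ℓ) t m 0)
      ≡⟨ sumBelow-extend N₂ (suc (suc N₂)) _ (ℕₚ.m≤n+m N₂ 2) (λ ℓ N₂≤ℓ →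
           arndtOfLength-long _ (suc ℓ) t m 0 (s≤s (ℕₚ.≤-trans t≤N₂ N₂≤ℓ))) ⟨
    nonemptyArndt (suc (suc N₂)) m t ∎)
    where
    t≤N₂ : t ≤ N₂
    t≤N₂ = ℕₚ.≤-pred (ℕₚ.≤-pred (ℕₚ.≤-trans 2+t≤n n≤2+N₂))

sumBelow-iverson-≡ᵇ : ∀ N a b → a < N → sumBelow N (λ k → iverson ((k ≡ᵇ a) ∧ (k ≡ᵇ b))) ≡ iverson (a ≡ᵇ b)
sumBelow-iverson-≡ᵇ (suc N) zero    b       _ =
  trans (cong (iverson (0 ≡ᵇ b) +_) (sumBelow-zero N λ _ _ → refl)) (ℕₚ.+-identityʳ _)
sumBelow-iverson-≡ᵇ (suc N) (suc a) zero    _ = sumBelow-zero N λ k _ → cong iverson (Bool.∧-zeroʳ (k ≡ᵇ a))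
sumBelow-iverson-≡ᵇ (suc N) (suc a) (suc b) (s≤s a<N) = sumBelow-iverson-≡ᵇ N a b a<N

arndtOfLength-single : ∀ N n m → n ≤ N → arndtOfLength N 1 n (suc m) 0 ≡ iverson (n ≡ᵇ suc m)
arndtOfLength-single N zero    m _   = sumBelow-zero N λ _ _ → refl
arndtOfLength-single N (suc a) m a<N = sumBelow-iverson-≡ᵇ N a m a<N

-- The number of pairs (a, m + 1) with a > m + 1 and a + m + 1 = n, i.e. [n ≥ 2m + 3].
widePairs : ℕ → ℕ → ℕ
widePairs n             zero    = iverson (3 ≤ᵇ n)
widePairs zero          (suc m) = 0
widePairs (suc zero)    (suc m) = 0
widePairs (suc (suc n)) (suc m) = widePairs n m

widePairs-small : ∀ n m → n ≤ 1 → widePairs n m ≡ 0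
widePairs-small zero       zero    _ = refl
widePairs-small zero       (suc m) _ = refl
widePairs-small (suc zero) zero    _ = refl
widePairs-small (suc zero) (suc m) _ = refl
widePairs-small (suc (suc n)) m (s≤s ())

unitPairSum-atZero : ∀ M n → n ≤ 2 + M → unitPairSum M (λ t → iverson (0 ≡ᵇ t)) n ≡ iverson (3 ≤ᵇ n)
unitPairSum-atZero M       zero                _ = unitPairSum-small M (λ t → iverson (0 ≡ᵇ t)) 0 z≤n
unitPairSum-atZero M       (suc zero)          _ = unitPairSum-small M (λ t → iverson (0 ≡ᵇ t)) 1 (s≤s z≤n)
unitPairSum-atZero M       (suc (suc zero))    _ = unitPairSum-small M (λ t → iverson (0 ≡ᵇ t)) 2 (s≤s (s≤s z≤n))
unitPairSum-atZero zero    (suc (suc (suc n))) (s≤s (s≤s ()))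
unitPairSum-atZero (suc M) (suc (suc (suc n))) (s≤s n≤2+M) =
  trans (cong (iverson (0 ≡ᵇ n) +_) (unitPairSum-atZero M (2 + n) n≤2+M)) (oneOfTwo n)
  where
  oneOfTwo : ∀ n → iverson (0 ≡ᵇ n) + iverson (3 ≤ᵇ 2 + n) ≡ 1
  oneOfTwo zero    = refl
  oneOfTwo (suc n) = refl

pairSum-finalPair : ∀ N n m → n ≤ N →
  pairSum N (λ t j → iverson ((j ≡ᵇ m) ∧ (0 ≡ᵇ t))) n ≡ widePairs n m
pairSum-finalPair N zero       m _ =
  trans (pairSum-zero N {λ t j → iverson ((j ≡ᵇ m) ∧ (0 ≡ᵇ t))} 0 λ _ _ ()) (sym (widePairs-small 0 m z≤n))
pairSum-finalPair N (suc zero) m _ =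
  trans (pairSum-zero N {λ t j → iverson ((j ≡ᵇ m) ∧ (0 ≡ᵇ t))} 1 λ { _ _ (s≤s ()) })
        (sym (widePairs-small 1 m (s≤s z≤n)))
pairSum-finalPair (suc M) (suc (suc n)) zero 2+n≤1+M = begin
  pairSum (suc M) (λ t j → iverson ((j ≡ᵇ 0) ∧ (0 ≡ᵇ t))) (2 + n)
    ≡⟨ pairSum-peel M (λ t j → iverson ((j ≡ᵇ 0) ∧ (0 ≡ᵇ t))) n ⟩
  unitPairSum M (λ t → iverson (0 ≡ᵇ t)) (2 + n) + pairSum M (λ _ _ → 0) n
    ≡⟨ cong₂ _+_ (unitPairSum-atZero M (2 + n) (ℕₚ.m≤n⇒m≤1+n 2+n≤1+M))
                 (pairSum-zero M {λ _ _ → 0} n λ _ _ _ → refl) ⟩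
  iverson (3 ≤ᵇ 2 + n) + 0
    ≡⟨ ℕₚ.+-identityʳ _ ⟩
  iverson (3 ≤ᵇ 2 + n) ∎
pairSum-finalPair (suc M) (suc (suc n)) (suc m) 2+n≤1+M = begin
  pairSum (suc M) (λ t j → iverson ((j ≡ᵇ suc m) ∧ (0 ≡ᵇ t))) (2 + n)
    ≡⟨ pairSum-peel M (λ t j → iverson ((j ≡ᵇ suc m) ∧ (0 ≡ᵇ t))) n ⟩
  unitPairSum M (λ _ → 0) (2 + n) + pairSum M (λ t j → iverson ((j ≡ᵇ m) ∧ (0 ≡ᵇ t))) n
    ≡⟨ cong₂ _+_ (sumBelow-zero M λ k _ → if-0 (3 + k ≤ᵇ 2 + n))
                 (pairSum-finalPair M n m (ℕₚ.<⇒≤ (ℕₚ.≤-pred 2+n≤1+M))) ⟩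
  widePairs n m ∎

-- The number of Arndt compositions of n of length 1 or 2 with last part m + 1.
tailCount : ℕ → ℕ → ℕ
tailCount m n = iverson (n ≡ᵇ suc m) + widePairs n m

nonemptyArndt-recurrence : ∀ N m n → n ≤ N →
  nonemptyArndt N (suc m) n ≡ tailCount m n + pairSum N (λ t _ → nonemptyArndt N (suc m) t) n
nonemptyArndt-recurrence N m n n≤N = begin
  nonemptyArndt N (suc m) n
    ≡⟨ nonemptyArndt-firstPair N (suc m) n n≤N ⟩
  arndtOfLength N 1 n (suc m) 0 + (pairSum N (λ t j → iverson ((j ≡ᵇ m) ∧ (0 ≡ᵇ t))) n + S)
    ≡⟨ cong₂ (λ a b → a + (b + S)) (arndtOfLength-single N n m n≤N) (pairSum-finalPair N n m n≤N) ⟩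
  iverson (n ≡ᵇ suc m) + (widePairs n m + S)
    ≡⟨ ℕₚ.+-assoc (iverson (n ≡ᵇ suc m)) _ _ ⟨
  tailCount m n + S ∎
  where
  S : ℕ
  S = pairSum N (λ t _ → nonemptyArndt N (suc m) t) n

nonemptyArndt-small : ∀ N m n → n ≤ N → n ≤ 2 → nonemptyArndt N (suc m) n ≡ tailCount m n
nonemptyArndt-small N m n n≤N n≤2 = begin
  nonemptyArndt N (suc m) n
    ≡⟨ nonemptyArndt-recurrence N m n n≤N ⟩
  tailCount m n + pairSum N (λ t _ → nonemptyArndt N (suc m) t) n
    ≡⟨ cong (tailCount m n +_) (pairSum-zero N n λ t _ 2+t≤n →
         subst (λ t → nonemptyArndt N (suc m) t ≡ 0) (sym (t≡0 2+t≤n)) (nonemptyArndt-zero N (suc m))) ⟩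
  tailCount m n + 0
    ≡⟨ ℕₚ.+-identityʳ _ ⟩
  tailCount m n ∎
  where
  t≡0 : ∀ {t} → 2 + t ≤ n → t ≡ 0
  t≡0 {zero}  _      = refl
  t≡0 {suc t} 3+t≤n = ⊥-elim (ℕₚ.<⇒≱ (s≤s (s≤s (s≤s z≤n))) (ℕₚ.≤-trans 3+t≤n n≤2))

-- (1 - x - x²) b = (1 - x)(1 - x²) β for b = nonemptyArndt N (m + 1) and β = tailCount m,
-- written without subtraction.
nonemptyArndt-linear : ∀ N m n → 3 + n ≤ N →
  nonemptyArndt N (suc m) (3 + n) + tailCount m (2 + n) + tailCount m (1 + n)
    ≡ nonemptyArndt N (suc m) (2 + n) + nonemptyArndt N (suc m) (1 + n) + tailCount m (3 + n) + tailCount m n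
nonemptyArndt-linear N m n 3+n≤N = ℕₚ.+-cancelʳ-≡ (S n) _ _ (begin
  b (3 + n) + β (2 + n) + β (1 + n) + S n
    ≡⟨ cong (λ x → x + β (2 + n) + β (1 + n) + S n) (rec (3 + n) 3+n≤N) ⟩
  β (3 + n) + S (3 + n) + β (2 + n) + β (1 + n) + S n
    ≡⟨ rearrange₁ (β (3 + n)) (S (3 + n)) (β (2 + n)) (β (1 + n)) (S n) ⟩
  β (3 + n) + β (2 + n) + β (1 + n) + (S (3 + n) + S n)
    ≡⟨ cong (β (3 + n) + β (2 + n) + β (1 + n) +_) (pairSum-recurrence N b n 3+n≤N) ⟩
  β (3 + n) + β (2 + n) + β (1 + n) + (b n + S (2 + n) + S (1 + n))
    ≡⟨ cong (λ x → β (3 + n) + β (2 + n) + β (1 + n) + (x + S (2 + n) + S (1 + n))) (rec n n≤N) ⟩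
  β (3 + n) + β (2 + n) + β (1 + n) + (β n + S n + S (2 + n) + S (1 + n))
    ≡⟨ rearrange₂ (β (3 + n)) (β (2 + n)) (β (1 + n)) (β n) (S n) (S (2 + n)) (S (1 + n)) ⟩
  β (2 + n) + S (2 + n) + (β (1 + n) + S (1 + n)) + β (3 + n) + β n + S n
    ≡⟨ cong₂ (λ x y → x + y + β (3 + n) + β n + S n) (rec (2 + n) 2+n≤N) (rec (1 + n) 1+n≤N) ⟨
  b (2 + n) + b (1 + n) + β (3 + n) + β n + S n ∎)
  where
  b β S : ℕ → ℕ
  b = nonemptyArndt N (suc m)
  β = tailCount m
  S = pairSum N (λ t _ → b t)
  rec : ∀ k → k ≤ N → b k ≡ β k + S k
  rec k = nonemptyArndt-recurrence N m k
  2+n≤N : 2 + n ≤ N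
  2+n≤N = ℕₚ.<⇒≤ 3+n≤N
  1+n≤N : 1 + n ≤ N
  1+n≤N = ℕₚ.<⇒≤ 2+n≤N
  n≤N : n ≤ N
  n≤N = ℕₚ.<⇒≤ 1+n≤N
  rearrange₁ : ∀ a s c d s₀ → a + s + c + d + s₀ ≡ a + c + d + (s + s₀)
  rearrange₁ = ℕ-Solver.solve-∀
  rearrange₂ : ∀ a c d e s₀ s₂ s₁ → a + c + d + (e + s₀ + s₂ + s₁) ≡ c + s₂ + (d + s₁) + a + e + s₀
  rearrange₂ = ℕ-Solver.solve-∀

arndtCount-zero : ∀ n → arndtCount n 0 ≡ iverson (0 ≡ᵇ n)
arndtCount-zero n = begin
  arndtCount n 0
    ≡⟨ arndtCount≡sumByLength n 0 ⟩
  iverson (0 ≡ᵇ n) + sumBelow n (λ ℓ → arndtOfLength n (suc ℓ) n 0 0)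
    ≡⟨ cong (iverson (0 ≡ᵇ n) +_) (sumBelow-zero n λ ℓ _ → arndtOfLength-lastZero n ℓ n 0) ⟩
  iverson (0 ≡ᵇ n) + 0
    ≡⟨ ℕₚ.+-identityʳ _ ⟩
  iverson (0 ≡ᵇ n) ∎

arndtCount-suc : ∀ n m → arndtCount n (suc m) ≡ nonemptyArndt n (suc m) n
arndtCount-suc n m = arndtCount≡sumByLength n (suc m)

-- Opened only now: with ℤ's prefix +_ in scope, the ℕ sections (x +_) above would be ambiguous.
open import Data.Integer as ℤ using (ℤ; +_)
import Data.Integer.Properties as ℤₚ
import Data.Integer.Tactic.RingSolver as ℤ-Solver

shift : (ℕ → ℤ) → ℕ → ℤ
shift f zero    = + 0
shift f (suc n) = f n

-- Multiplication of a sequence, seen as a power series in x, by 1 - x - x² and by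
-- (1 - x)(1 - x²) = 1 - x - x² + x³.
fibDiff pairDiff : (ℕ → ℤ) → ℕ → ℤ
fibDiff f n = f n ℤ.- shift f n ℤ.- shift (shift f) n
pairDiff f n = fibDiff f n ℤ.+ shift (shift (shift f)) n

shift-cong-below : ∀ n {f g : ℕ → ℤ} → (∀ k → k ≤ n → f k ≡ g k) → shift f n ≡ shift g n
shift-cong-below zero    eq = refl
shift-cong-below (suc n) eq = eq n (ℕₚ.n≤1+n n)

fibDiff-cong-below : ∀ n {f g : ℕ → ℤ} → (∀ k → k ≤ n → f k ≡ g k) → fibDiff f n ≡ fibDiff g n
fibDiff-cong-below n eq = cong₂ ℤ._-_
  (cong₂ ℤ._-_ (eq n ℕₚ.≤-refl) (shift-cong-below n eq))
  (shift-cong-below n λ k k≤n → shift-cong-below k λ i i≤k → eq i (ℕₚ.≤-trans i≤k k≤n))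

fibDiff-injective-below : ∀ N (f g : ℕ → ℤ) → (∀ n → n ≤ N → fibDiff f n ≡ fibDiff g n) →
                          ∀ n → n ≤ N → f n ≡ g n
fibDiff-injective-below N f g eq n n≤N = proj₁ (agree n n≤N)
  where
  reconstruct : ∀ (f : ℕ → ℤ) n → f n ≡ fibDiff f n ℤ.+ shift f n ℤ.+ shift (shift f) n
  reconstruct f n = solution (f n) (shift f n) (shift (shift f) n)
    where
    solution : ∀ a b c → a ≡ a ℤ.- b ℤ.- c ℤ.+ b ℤ.+ c
    solution = ℤ-Solver.solve-∀
  step : ∀ n → n ≤ N → shift f n ≡ shift g n → shift (shift f) n ≡ shift (shift g) n → f n ≡ g n
  step n n≤N eq₁ eq₂ = begin
    f n                                               ≡⟨ reconstruct f n ⟩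
    fibDiff f n ℤ.+ shift f n ℤ.+ shift (shift f) n   ≡⟨ cong₂ ℤ._+_ (cong₂ ℤ._+_ (eq n n≤N) eq₁) eq₂ ⟩
    fibDiff g n ℤ.+ shift g n ℤ.+ shift (shift g) n   ≡⟨ reconstruct g n ⟨
    g n                                               ∎
  agree : ∀ n → n ≤ N → f n ≡ g n × shift f n ≡ shift g n
  agree zero    0≤N = step 0 0≤N refl refl , refl
  agree (suc n) n<N with agree n (ℕₚ.<⇒≤ n<N)
  ... | fn≡gn , shift-fn≡gn = step (suc n) n<N fn≡gn shift-fn≡gn , fn≡gn

pairDiff-cong : ∀ {f g : ℕ → ℤ} → (∀ k → f k ≡ g k) → ∀ n → pairDiff f n ≡ pairDiff g n
pairDiff-cong eq n = cong₂ ℤ._+_ (fibDiff-cong-below n λ k _ → eq k)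
  (shift-cong-below n λ k _ → shift-cong-below k λ j _ → shift-cong-below j λ i _ → eq i)

pairDiff-+ : ∀ f g n → pairDiff (λ k → f k ℤ.+ g k) n ≡ pairDiff f n ℤ.+ pairDiff g n
pairDiff-+ f g = byCases
  where
  linear : ∀ a₃ b₃ a₂ b₂ a₁ b₁ a₀ b₀ →
    a₃ ℤ.+ b₃ ℤ.- (a₂ ℤ.+ b₂) ℤ.- (a₁ ℤ.+ b₁) ℤ.+ (a₀ ℤ.+ b₀)
      ≡ a₃ ℤ.- a₂ ℤ.- a₁ ℤ.+ a₀ ℤ.+ (b₃ ℤ.- b₂ ℤ.- b₁ ℤ.+ b₀)
  linear = ℤ-Solver.solve-∀
  byCases : ∀ n → pairDiff (λ k → f k ℤ.+ g k) n ≡ pairDiff f n ℤ.+ pairDiff g n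
  byCases zero                = linear (f 0) (g 0) (+ 0) (+ 0) (+ 0) (+ 0) (+ 0) (+ 0)
  byCases (suc zero)          = linear (f 1) (g 1) (f 0) (g 0) (+ 0) (+ 0) (+ 0) (+ 0)
  byCases (suc (suc zero))    = linear (f 2) (g 2) (f 1) (g 1) (f 0) (g 0) (+ 0) (+ 0)
  byCases (suc (suc (suc n))) = linear (f (3 ℕ.+ n)) (g (3 ℕ.+ n)) (f (2 ℕ.+ n)) (g (2 ℕ.+ n))
                                       (f (1 ℕ.+ n)) (g (1 ℕ.+ n)) (f n) (g n)

pairDiff-shift : ∀ f g → (∀ k → f k ≡ shift g k) → ∀ n → pairDiff f (suc n) ≡ pairDiff g n
pairDiff-shift f g eq n = pairDiff-cong eq (suc n)

fibDiff≡pairDiff-from-ℕ : ∀ (b c : ℕ → ℕ) n →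
  b (3 ℕ.+ n) ℕ.+ c (2 ℕ.+ n) ℕ.+ c (1 ℕ.+ n) ≡ b (2 ℕ.+ n) ℕ.+ b (1 ℕ.+ n) ℕ.+ c (3 ℕ.+ n) ℕ.+ c n →
  fibDiff (λ k → + b k) (3 ℕ.+ n) ≡ pairDiff (λ k → + c k) (3 ℕ.+ n)
fibDiff≡pairDiff-from-ℕ b c n eq = begin
  + b₃ ℤ.- + b₂ ℤ.- + b₁
    ≡⟨ isolate (+ b₃) (+ b₂) (+ b₁) (+ c₂) (+ c₁) ⟩
  + b₃ ℤ.+ + c₂ ℤ.+ + c₁ ℤ.- (+ b₂ ℤ.+ + b₁ ℤ.+ + c₂ ℤ.+ + c₁)
    ≡⟨ cong (ℤ._- (+ b₂ ℤ.+ + b₁ ℤ.+ + c₂ ℤ.+ + c₁)) (begin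
         + b₃ ℤ.+ + c₂ ℤ.+ + c₁                 ≡⟨ pos-+₃ b₃ c₂ c₁ ⟨
         + (b₃ ℕ.+ c₂ ℕ.+ c₁)                   ≡⟨ cong +_ eq ⟩
         + (b₂ ℕ.+ b₁ ℕ.+ c₃ ℕ.+ c₀)            ≡⟨ ℤₚ.pos-+ (b₂ ℕ.+ b₁ ℕ.+ c₃) c₀ ⟩
         + (b₂ ℕ.+ b₁ ℕ.+ c₃) ℤ.+ + c₀          ≡⟨ cong (ℤ._+ + c₀) (pos-+₃ b₂ b₁ c₃) ⟩
         + b₂ ℤ.+ + b₁ ℤ.+ + c₃ ℤ.+ + c₀        ∎) ⟩
  + b₂ ℤ.+ + b₁ ℤ.+ + c₃ ℤ.+ + c₀ ℤ.- (+ b₂ ℤ.+ + b₁ ℤ.+ + c₂ ℤ.+ + c₁)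
    ≡⟨ cancel (+ b₂) (+ b₁) (+ c₃) (+ c₀) (+ c₂) (+ c₁) ⟩
  + c₃ ℤ.- + c₂ ℤ.- + c₁ ℤ.+ + c₀ ∎
  where
  b₃ b₂ b₁ c₃ c₂ c₁ c₀ : ℕ
  b₃ = b (3 ℕ.+ n)
  b₂ = b (2 ℕ.+ n)
  b₁ = b (1 ℕ.+ n)
  c₃ = c (3 ℕ.+ n)
  c₂ = c (2 ℕ.+ n)
  c₁ = c (1 ℕ.+ n)
  c₀ = c n
  pos-+₃ : ∀ x y z → + (x ℕ.+ y ℕ.+ z) ≡ + x ℤ.+ + y ℤ.+ + z
  pos-+₃ x y z = trans (ℤₚ.pos-+ (x ℕ.+ y) z) (cong (ℤ._+ + z) (ℤₚ.pos-+ x y))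
  isolate : ∀ x y z u v → x ℤ.- y ℤ.- z ≡ x ℤ.+ u ℤ.+ v ℤ.- (y ℤ.+ z ℤ.+ u ℤ.+ v)
  isolate = ℤ-Solver.solve-∀
  cancel : ∀ y z w t u v → y ℤ.+ z ℤ.+ w ℤ.+ t ℤ.- (y ℤ.+ z ℤ.+ u ℤ.+ v) ≡ w ℤ.- u ℤ.- v ℤ.+ t
  cancel = ℤ-Solver.solve-∀

nonemptyArndt-fibDiff-initial : ∀ N m n → n ≤ N → n ≤ 2 →
  fibDiff (λ k → + nonemptyArndt N (suc m) k) n ≡ fibDiff (λ k → + tailCount m k) n ℤ.+ + 0
nonemptyArndt-fibDiff-initial N m n n≤N n≤2 = trans
  (fibDiff-cong-below n λ k k≤n →
    cong +_ (nonemptyArndt-small N m k (ℕₚ.≤-trans k≤n n≤N) (ℕₚ.≤-trans k≤n n≤2)))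
  (sym (ℤₚ.+-identityʳ _))

nonemptyArndt-fibDiff : ∀ N m n → n ≤ N →
  fibDiff (λ k → + nonemptyArndt N (suc m) k) n ≡ pairDiff (λ k → + tailCount m k) n
nonemptyArndt-fibDiff N m zero                n≤N = nonemptyArndt-fibDiff-initial N m 0 n≤N z≤n
nonemptyArndt-fibDiff N m (suc zero)          n≤N = nonemptyArndt-fibDiff-initial N m 1 n≤N (s≤s z≤n)
nonemptyArndt-fibDiff N m (suc (suc zero))    n≤N = nonemptyArndt-fibDiff-initial N m 2 n≤N (s≤s (s≤s z≤n))
nonemptyArndt-fibDiff N m (suc (suc (suc n))) n≤N =
  fibDiff≡pairDiff-from-ℕ (nonemptyArndt N (suc m)) (tailCount m) n (nonemptyArndt-linear N m n n≤N)

arndtCount-fibDiff : ∀ m n →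
  fibDiff (λ k → + arndtCount k (suc m)) n ≡ pairDiff (λ k → + tailCount m k) n
arndtCount-fibDiff m n = begin
  fibDiff (λ k → + arndtCount k (suc m)) n
    ≡⟨ fibDiff-cong-below n (λ k k≤n → trans (cong +_ (arndtCount-suc k m)) (boundIrrelevant k k≤n)) ⟩
  fibDiff (λ k → + nonemptyArndt n (suc m) k) n
    ≡⟨ nonemptyArndt-fibDiff n m n ℕₚ.≤-refl ⟩
  pairDiff (λ k → + tailCount m k) n ∎
  where
  boundIrrelevant : ∀ k → k ≤ n → + nonemptyArndt k (suc m) k ≡ + nonemptyArndt n (suc m) k
  boundIrrelevant k k≤n =
    fibDiff-injective-below k (λ j → + nonemptyArndt k (suc m) j) (λ j → + nonemptyArndt n (suc m) j)
    (λ j j≤k → trans (nonemptyArndt-fibDiff k m j j≤k)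
                     (sym (nonemptyArndt-fibDiff n m j (ℕₚ.≤-trans j≤k k≤n))))
    k ℕₚ.≤-refl

sumTo-cong : ∀ n {f g : ℕ → ℤ} → (∀ i → i ≤ n → f i ≡ g i) → sumTo n f ≡ sumTo n g
sumTo-cong zero    eq = eq 0 z≤n
sumTo-cong (suc n) eq =
  cong₂ ℤ._+_ (sumTo-cong n λ i i≤n → eq i (ℕₚ.m≤n⇒m≤1+n i≤n)) (eq (suc n) ℕₚ.≤-refl)

sumTo-zero : ∀ n {f : ℕ → ℤ} → (∀ i → i ≤ n → f i ≡ + 0) → sumTo n f ≡ + 0
sumTo-zero zero    eq = eq 0 z≤n
sumTo-zero (suc n) eq =
  cong₂ ℤ._+_ (sumTo-zero n λ i i≤n → eq i (ℕₚ.m≤n⇒m≤1+n i≤n)) (eq (suc n) ℕₚ.≤-refl)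

sumTo-suc : ∀ n (f : ℕ → ℤ) → sumTo (suc n) f ≡ f 0 ℤ.+ sumTo n (λ i → f (suc i))
sumTo-suc zero    f = refl
sumTo-suc (suc n) f = begin
  sumTo (suc n) f ℤ.+ f (suc (suc n))
    ≡⟨ cong (ℤ._+ f (suc (suc n))) (sumTo-suc n f) ⟩
  f 0 ℤ.+ sumTo n (λ i → f (suc i)) ℤ.+ f (suc (suc n))
    ≡⟨ ℤₚ.+-assoc (f 0) _ _ ⟩
  f 0 ℤ.+ sumTo (suc n) (λ i → f (suc i)) ∎

sumTo-head : ∀ n (f : ℕ → ℤ) → (∀ i → f (suc i) ≡ + 0) → sumTo n f ≡ f 0
sumTo-head zero    f eq = refl
sumTo-head (suc n) f eq = begin
  sumTo (suc n) f                         ≡⟨ sumTo-suc n f ⟩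
  f 0 ℤ.+ sumTo n (λ i → f (suc i))       ≡⟨ cong (λ s → f 0 ℤ.+ s) (sumTo-zero n λ i _ → eq i) ⟩
  f 0 ℤ.+ + 0                             ≡⟨ ℤₚ.+-identityʳ (f 0) ⟩
  f 0                                     ∎

sumTo-last : ∀ n (f : ℕ → ℤ) → (∀ i → suc i ≤ n → f i ≡ + 0) → sumTo n f ≡ f n
sumTo-last zero    f eq = refl
sumTo-last (suc n) f eq = trans
  (cong (ℤ._+ f (suc n)) (sumTo-zero n λ i i≤n → eq i (s≤s i≤n))) (ℤₚ.+-identityˡ (f (suc n)))

sumTo-+ : ∀ n (f g : ℕ → ℤ) → sumTo n (λ i → f i ℤ.+ g i) ≡ sumTo n f ℤ.+ sumTo n g
sumTo-+ zero    f g = refl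
sumTo-+ (suc n) f g = begin
  sumTo n (λ i → f i ℤ.+ g i) ℤ.+ (f (suc n) ℤ.+ g (suc n))
    ≡⟨ cong (ℤ._+ (f (suc n) ℤ.+ g (suc n))) (sumTo-+ n f g) ⟩
  sumTo n f ℤ.+ sumTo n g ℤ.+ (f (suc n) ℤ.+ g (suc n))
    ≡⟨ interchange (sumTo n f) (sumTo n g) (f (suc n)) (g (suc n)) ⟩
  sumTo (suc n) f ℤ.+ sumTo (suc n) g ∎
  where
  interchange : ∀ a b c d → a ℤ.+ b ℤ.+ (c ℤ.+ d) ≡ a ℤ.+ c ℤ.+ (b ℤ.+ d)
  interchange = ℤ-Solver.solve-∀

sumTo-minus : ∀ n (f g : ℕ → ℤ) → sumTo n (λ i → f i ℤ.- g i) ≡ sumTo n f ℤ.- sumTo n g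
sumTo-minus zero    f g = refl
sumTo-minus (suc n) f g = begin
  sumTo n (λ i → f i ℤ.- g i) ℤ.+ (f (suc n) ℤ.- g (suc n))
    ≡⟨ cong (ℤ._+ (f (suc n) ℤ.- g (suc n))) (sumTo-minus n f g) ⟩
  sumTo n f ℤ.- sumTo n g ℤ.+ (f (suc n) ℤ.- g (suc n))
    ≡⟨ interchange (sumTo n f) (sumTo n g) (f (suc n)) (g (suc n)) ⟩
  sumTo (suc n) f ℤ.- sumTo (suc n) g ∎
  where
  interchange : ∀ a b c d → a ℤ.- b ℤ.+ (c ℤ.- d) ≡ a ℤ.+ c ℤ.- (b ℤ.+ d)
  interchange = ℤ-Solver.solve-∀

sumTo-*ˡ : ∀ n c (f : ℕ → ℤ) → sumTo n (λ i → c ℤ.* f i) ≡ c ℤ.* sumTo n f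
sumTo-*ˡ zero    c f = refl
sumTo-*ˡ (suc n) c f = begin
  sumTo n (λ i → c ℤ.* f i) ℤ.+ c ℤ.* f (suc n)
    ≡⟨ cong (ℤ._+ c ℤ.* f (suc n)) (sumTo-*ˡ n c f) ⟩
  c ℤ.* sumTo n f ℤ.+ c ℤ.* f (suc n)
    ≡⟨ ℤₚ.*-distribˡ-+ c (sumTo n f) (f (suc n)) ⟨
  c ℤ.* sumTo (suc n) f ∎

sumTo-reverse : ∀ n (f : ℕ → ℤ) → sumTo n f ≡ sumTo n (λ i → f (n ∸ i))
sumTo-reverse zero    f = refl
sumTo-reverse (suc n) f = begin
  sumTo n f ℤ.+ f (suc n)                   ≡⟨ cong (ℤ._+ f (suc n)) (sumTo-reverse n f) ⟩
  sumTo n (λ i → f (n ∸ i)) ℤ.+ f (suc n)   ≡⟨ ℤₚ.+-comm _ (f (suc n)) ⟩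
  f (suc n) ℤ.+ sumTo n (λ i → f (n ∸ i))   ≡⟨ sumTo-suc n (λ i → f (suc n ∸ i)) ⟨
  sumTo (suc n) (λ i → f (suc n ∸ i))       ∎

infix 4 _≐_
_≐_ : Series → Series → Set
f ≐ g = ∀ n m → f n m ≡ g n m

≐-trans : ∀ {f g h} → f ≐ g → g ≐ h → f ≐ h
≐-trans f≐g g≐h n m = trans (f≐g n m) (g≐h n m)

≐-sym : ∀ {f g} → f ≐ g → g ≐ f
≐-sym f≐g n m = sym (f≐g n m)

⊛-cong : ∀ {f f′ g g′} → f ≐ f′ → g ≐ g′ → f ⊛ g ≐ f′ ⊛ g′
⊛-cong f≐f′ g≐g′ n m =
  sumTo-cong n λ i _ → sumTo-cong m λ j _ → cong₂ ℤ._*_ (f≐f′ i j) (g≐g′ (n ∸ i) (m ∸ j))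

⊛-distribʳ-⊕ : ∀ f g h → (f ⊕ g) ⊛ h ≐ f ⊛ h ⊕ g ⊛ h
⊛-distribʳ-⊕ f g h n m = trans
  (sumTo-cong n λ i _ → trans
    (sumTo-cong m λ j _ → ℤₚ.*-distribʳ-+ (h (n ∸ i) (m ∸ j)) (f i j) (g i j))
    (sumTo-+ m _ _))
  (sumTo-+ n _ _)

⊛-distribʳ-⊖ : ∀ f g h → (f ⊖ g) ⊛ h ≐ f ⊛ h ⊖ g ⊛ h
⊛-distribʳ-⊖ f g h n m = trans
  (sumTo-cong n λ i _ → trans
    (sumTo-cong m λ j _ → *-distribʳ-minus (h (n ∸ i) (m ∸ j)) (f i j) (g i j))
    (sumTo-minus m _ _))
  (sumTo-minus n _ _)
  where
  *-distribʳ-minus : ∀ c a b → (a ℤ.- b) ℤ.* c ≡ a ℤ.* c ℤ.- b ℤ.* c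
  *-distribʳ-minus = ℤ-Solver.solve-∀

⊛-comm : ∀ f g → f ⊛ g ≐ g ⊛ f
⊛-comm f g n m = trans (sumTo-reverse n _) (sumTo-cong n λ i i≤n →
  trans (sumTo-reverse m _) (sumTo-cong m λ j j≤m → begin
    f (n ∸ i) (m ∸ j) ℤ.* g (n ∸ (n ∸ i)) (m ∸ (m ∸ j))
      ≡⟨ cong₂ (λ a b → f (n ∸ i) (m ∸ j) ℤ.* g a b) (ℕₚ.m∸[m∸n]≡n i≤n) (ℕₚ.m∸[m∸n]≡n j≤m) ⟩
    f (n ∸ i) (m ∸ j) ℤ.* g i j
      ≡⟨ ℤₚ.*-comm (f (n ∸ i) (m ∸ j)) (g i j) ⟩
    g i j ℤ.* f (n ∸ i) (m ∸ j) ∎))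

⊛-identityʳ : ∀ f → f ⊛ const (+ 1) ≐ f
⊛-identityʳ f n m = begin
  sumTo n (λ i → sumTo m (λ j → f i j ℤ.* const (+ 1) (n ∸ i) (m ∸ j)))
    ≡⟨ sumTo-last n _ (λ i i<n → sumTo-zero m λ j _ →
         trans (cong (f i j ℤ.*_) (off-row n i (m ∸ j) i<n)) (ℤₚ.*-zeroʳ (f i j))) ⟩
  sumTo m (λ j → f n j ℤ.* const (+ 1) (n ∸ n) (m ∸ j))
    ≡⟨ sumTo-last m _ (λ j j<m →
         trans (cong (f n j ℤ.*_) (off-column (n ∸ n) m j j<m)) (ℤₚ.*-zeroʳ (f n j))) ⟩
  f n m ℤ.* const (+ 1) (n ∸ n) (m ∸ m)
    ≡⟨ cong₂ (λ a b → f n m ℤ.* const (+ 1) a b) (ℕₚ.n∸n≡0 n) (ℕₚ.n∸n≡0 m) ⟩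
  f n m ℤ.* + 1
    ≡⟨ ℤₚ.*-identityʳ (f n m) ⟩
  f n m ∎
  where
  off-row : ∀ n i j → suc i ≤ n → const (+ 1) (n ∸ i) j ≡ + 0
  off-row (suc n) zero    j _             = refl
  off-row (suc n) (suc i) j (s≤s i<n) = off-row n i j i<n
  off-column : ∀ a m j → suc j ≤ m → const (+ 1) a (m ∸ j) ≡ + 0
  off-column zero    (suc m) zero    _             = refl
  off-column (suc a) (suc m) zero    _             = refl
  off-column a       (suc m) (suc j) (s≤s j<m) = off-column a m j j<m

shiftX shiftY : Series → Series
shiftX f zero    m = + 0
shiftX f (suc n) m = f n m
shiftY f n zero    = + 0
shiftY f n (suc m) = f n m

scale : ℤ → Series → Series
scale c f n m = c ℤ.* f n m

-- A series whose left multiplication is given by an operator that computes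
-- by recursion on the indices; this is what lets the final identity reduce.
record Multiplier (E : Series) : Set where
  field
    act      : Series → Series
    act-cong : ∀ {f g} → f ≐ g → act f ≐ act g
    ⊛-act    : ∀ h → E ⊛ h ≐ act h
    act-⊛    : ∀ g h → act g ⊛ h ≐ act (g ⊛ h)

open Multiplier

X-multiplier : Multiplier X
X-multiplier .act = shiftX
X-multiplier .act-cong eq zero    m = refl
X-multiplier .act-cong eq (suc n) m = eq n m
X-multiplier .⊛-act h zero    m = sumTo-zero m λ _ _ → refl
X-multiplier .⊛-act h (suc n) m = begin
  sumTo (suc n) (λ i → sumTo m (λ j → X i j ℤ.* h (suc n ∸ i) (m ∸ j)))
    ≡⟨ sumTo-suc n _ ⟩
  sumTo m (λ j → + 0) ℤ.+ sumTo n (λ i → sumTo m (λ j → X (suc i) j ℤ.* h (n ∸ i) (m ∸ j)))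
    ≡⟨ cong₂ ℤ._+_ (sumTo-zero m λ _ _ → refl)
         (sumTo-head n _ λ i → sumTo-zero m λ _ _ → refl) ⟩
  + 0 ℤ.+ sumTo m (λ j → X 1 j ℤ.* h n (m ∸ j))
    ≡⟨ ℤₚ.+-identityˡ _ ⟩
  sumTo m (λ j → X 1 j ℤ.* h n (m ∸ j))
    ≡⟨ sumTo-head m _ (λ _ → refl) ⟩
  + 1 ℤ.* h n (m ∸ 0)
    ≡⟨ ℤₚ.*-identityˡ (h n m) ⟩
  h n m ∎
X-multiplier .act-⊛ g h zero    m = sumTo-zero m λ _ _ → refl
X-multiplier .act-⊛ g h (suc n) m = begin
  sumTo (suc n) (λ i → sumTo m (λ j → shiftX g i j ℤ.* h (suc n ∸ i) (m ∸ j)))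
    ≡⟨ sumTo-suc n _ ⟩
  sumTo m (λ j → + 0) ℤ.+ (g ⊛ h) n m
    ≡⟨ cong (ℤ._+ (g ⊛ h) n m) (sumTo-zero m λ _ _ → refl) ⟩
  + 0 ℤ.+ (g ⊛ h) n m
    ≡⟨ ℤₚ.+-identityˡ _ ⟩
  (g ⊛ h) n m ∎

Y-multiplier : Multiplier Y
Y-multiplier .act = shiftY
Y-multiplier .act-cong eq n zero    = refl
Y-multiplier .act-cong eq n (suc m) = eq n m
Y-multiplier .⊛-act h n m = trans
  (sumTo-head n _ λ i → sumTo-zero m λ _ _ → refl)
  (column m)
  where
  column : ∀ m → sumTo m (λ j → Y 0 j ℤ.* h n (m ∸ j)) ≡ shiftY h n m
  column zero    = refl
  column (suc m) = begin
    sumTo (suc m) (λ j → Y 0 j ℤ.* h n (suc m ∸ j))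
      ≡⟨ sumTo-suc m _ ⟩
    + 0 ℤ.+ sumTo m (λ j → Y 0 (suc j) ℤ.* h n (m ∸ j))
      ≡⟨ ℤₚ.+-identityˡ _ ⟩
    sumTo m (λ j → Y 0 (suc j) ℤ.* h n (m ∸ j))
      ≡⟨ sumTo-head m _ (λ _ → refl) ⟩
    + 1 ℤ.* h n (m ∸ 0)
      ≡⟨ ℤₚ.*-identityˡ (h n m) ⟩
    h n m ∎
Y-multiplier .act-⊛ g h n zero    = sumTo-zero n λ _ _ → refl
Y-multiplier .act-⊛ g h n (suc m) = sumTo-cong n λ i _ →
  trans (sumTo-suc m _) (ℤₚ.+-identityˡ _)

const-multiplier : ∀ c → Multiplier (const c)
const-multiplier c .act = scale c
const-multiplier c .act-cong eq n m = cong (c ℤ.*_) (eq n m)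
const-multiplier c .⊛-act h n m = trans
  (sumTo-head n _ λ i → sumTo-zero m λ _ _ → refl)
  (sumTo-head m _ λ _ → refl)
const-multiplier c .act-⊛ g h n m = trans
  (sumTo-cong n λ i _ → trans
    (sumTo-cong m λ j _ → ℤₚ.*-assoc c (g i j) (h (n ∸ i) (m ∸ j)))
    (sumTo-*ˡ m c _))
  (sumTo-*ˡ n c _)

⊕-multiplier : ∀ {A B} → Multiplier A → Multiplier B → Multiplier (A ⊕ B)
⊕-multiplier a b .act h = a .act h ⊕ b .act h
⊕-multiplier a b .act-cong eq n m = cong₂ ℤ._+_ (a .act-cong eq n m) (b .act-cong eq n m)
⊕-multiplier {A} {B} a b .⊛-act h n m =
  trans (⊛-distribʳ-⊕ A B h n m) (cong₂ ℤ._+_ (a .⊛-act h n m) (b .⊛-act h n m))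
⊕-multiplier a b .act-⊛ g h n m =
  trans (⊛-distribʳ-⊕ (a .act g) (b .act g) h n m)
        (cong₂ ℤ._+_ (a .act-⊛ g h n m) (b .act-⊛ g h n m))

⊖-multiplier : ∀ {A B} → Multiplier A → Multiplier B → Multiplier (A ⊖ B)
⊖-multiplier a b .act h = a .act h ⊖ b .act h
⊖-multiplier a b .act-cong eq n m = cong₂ ℤ._-_ (a .act-cong eq n m) (b .act-cong eq n m)
⊖-multiplier {A} {B} a b .⊛-act h n m =
  trans (⊛-distribʳ-⊖ A B h n m) (cong₂ ℤ._-_ (a .⊛-act h n m) (b .⊛-act h n m))
⊖-multiplier a b .act-⊛ g h n m =
  trans (⊛-distribʳ-⊖ (a .act g) (b .act g) h n m)
        (cong₂ ℤ._-_ (a .act-⊛ g h n m) (b .act-⊛ g h n m))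

⊛-multiplier : ∀ {A B} → Multiplier A → Multiplier B → Multiplier (A ⊛ B)
⊛-multiplier a b .act h = a .act (b .act h)
⊛-multiplier a b .act-cong eq = a .act-cong (b .act-cong eq)
⊛-multiplier {A} {B} a b .⊛-act h =
  ≐-trans (⊛-cong {g = h} (a .⊛-act B) (λ _ _ → refl))
  (≐-trans (a .act-⊛ B h) (a .act-cong (b .⊛-act h)))
⊛-multiplier a b .act-⊛ g h =
  ≐-trans (a .act-⊛ (b .act g) h) (a .act-cong (b .act-⊛ g h))

^ˢ-multiplier : ∀ {E} → Multiplier E → ∀ k → Multiplier (E ^ˢ k)
^ˢ-multiplier e zero    = const-multiplier (+ 1)
^ˢ-multiplier e (suc k) = ⊛-multiplier e (^ˢ-multiplier e k)

⊛-assoc : ∀ {A B} → Multiplier A → Multiplier B → ∀ h → (A ⊛ B) ⊛ h ≐ A ⊛ (B ⊛ h)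
⊛-assoc a b h = ≐-trans (⊛-multiplier a b .⊛-act h)
  (≐-trans (a .act-cong (≐-sym (b .⊛-act h))) (≐-sym (a .⊛-act _)))

act-⊕ : ∀ {E} (e : Multiplier E) f g → e .act (f ⊕ g) ≐ e .act f ⊕ e .act g
act-⊕ {E} e f g = ≐-trans (≐-sym (e .⊛-act (f ⊕ g)))
  (≐-trans (⊛-comm E (f ⊕ g))
  (≐-trans (⊛-distribʳ-⊕ f g E) λ n m →
    cong₂ ℤ._+_ (trans (⊛-comm f E n m) (e .⊛-act f n m))
                (trans (⊛-comm g E n m) (e .⊛-act g n m))))

P Q R : Series
P = const (+ 1) ⊖ X ⊖ X ^ˢ 2
Q = const (+ 1) ⊖ X ⊛ Y
R = const (+ 1) ⊖ X ^ˢ 2 ⊛ Y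

P-mul : Multiplier P
P-mul = ⊖-multiplier (⊖-multiplier (const-multiplier (+ 1)) X-multiplier) (^ˢ-multiplier X-multiplier 2)

Q-mul : Multiplier Q
Q-mul = ⊖-multiplier (const-multiplier (+ 1)) (⊛-multiplier X-multiplier Y-multiplier)

R-mul : Multiplier R
R-mul = ⊖-multiplier (const-multiplier (+ 1)) (⊛-multiplier (^ˢ-multiplier X-multiplier 2) Y-multiplier)

QR-mul : Multiplier (Q ⊛ R)
QR-mul = ⊛-multiplier Q-mul R-mul

numerator-mul : Multiplier numerator
numerator-mul =
  ⊖-multiplier (⊖-multiplier (⊕-multiplier (⊕-multiplier (⊖-multiplier (⊖-multiplier (⊖-multiplier
    (const-multiplier _) X-multiplier) (^ˢ-multiplier X-multiplier 2))
    (⊛-multiplier (^ˢ-multiplier X-multiplier 2) Y-multiplier))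
    (⊛-multiplier (⊛-multiplier (const-multiplier _) (^ˢ-multiplier X-multiplier 3)) Y-multiplier))
    (⊛-multiplier (⊛-multiplier (const-multiplier _) (^ˢ-multiplier X-multiplier 4)) Y-multiplier))
    (⊛-multiplier (^ˢ-multiplier X-multiplier 5) Y-multiplier))
    (⊛-multiplier (^ˢ-multiplier X-multiplier 4) (^ˢ-multiplier Y-multiplier 2))

denominator-act : ∀ h → denominator ⊛ h ≐ QR-mul .act (P-mul .act h)
denominator-act h = ≐-trans
  (⊛-cong {g = h} (≐-trans (⊛-assoc P-mul Q-mul R) (⊛-comm P (Q ⊛ R))) (λ _ _ → refl))
  (⊛-multiplier QR-mul P-mul .⊛-act h)

P-act-column : ∀ h n m → P-mul .act h n m ≡ fibDiff (λ k → h k m) n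
P-act-column h zero                m = cong (λ a → a ℤ.- + 0 ℤ.- + 0) (ℤₚ.*-identityˡ (h 0 m))
P-act-column h (suc zero)          m = cong (λ a → a ℤ.- h 0 m ℤ.- + 0) (ℤₚ.*-identityˡ (h 1 m))
P-act-column h (suc (suc n))       m =
  cong₂ (λ a c → a ℤ.- h (suc n) m ℤ.- c) (ℤₚ.*-identityˡ (h (2 ℕ.+ n) m)) (ℤₚ.*-identityˡ (h n m))

-- (1 - x - x²) A. By arndtCount-fibDiff, its column m ≥ 1 is (1 - x)(1 - x²) times
-- x^m (diagonalPart) plus x^(2m+1) / (1 - x) (widePart).
diagonalPart widePart : Series
diagonalPart n zero    = fibDiff (λ k → + iverson (0 ≡ᵇ k)) n
diagonalPart n (suc m) = pairDiff (λ k → + iverson (k ≡ᵇ suc m)) n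
widePart n zero    = + 0
widePart n (suc m) = pairDiff (λ k → + widePairs k m) n

reducedGF : Series
reducedGF = diagonalPart ⊕ widePart

P-act-arndtGF : P-mul .act arndtGF ≐ reducedGF
P-act-arndtGF n zero = begin
  P-mul .act arndtGF n 0
    ≡⟨ P-act-column arndtGF n 0 ⟩
  fibDiff (λ k → + arndtCount k 0) n
    ≡⟨ fibDiff-cong-below n (λ k _ → cong +_ (arndtCount-zero k)) ⟩
  fibDiff (λ k → + iverson (0 ≡ᵇ k)) n
    ≡⟨ ℤₚ.+-identityʳ _ ⟨
  diagonalPart n 0 ℤ.+ widePart n 0 ∎
P-act-arndtGF n (suc m) = begin
  P-mul .act arndtGF n (suc m)
    ≡⟨ P-act-column arndtGF n (suc m) ⟩
  fibDiff (λ k → + arndtCount k (suc m)) n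
    ≡⟨ arndtCount-fibDiff m n ⟩
  pairDiff (λ k → + tailCount m k) n
    ≡⟨ pairDiff-cong (λ k → ℤₚ.pos-+ (iverson (k ≡ᵇ suc m)) _) n ⟩
  pairDiff (λ k → + iverson (k ≡ᵇ suc m) ℤ.+ + widePairs k m) n
    ≡⟨ pairDiff-+ (λ k → + iverson (k ≡ᵇ suc m)) (λ k → + widePairs k m) n ⟩
  diagonalPart n (suc m) ℤ.+ widePart n (suc m) ∎

DiagonalBeyond SteepBeyond VanishesBeyond : ℕ → Series → Set
DiagonalBeyond c h = ∀ n m → c < m → h n m ≡ shiftX (shiftY h) n m
SteepBeyond    c h = ∀ n m → c < m → h n m ≡ shiftX (shiftX (shiftY h)) n m
VanishesBeyond c h = ∀ n m → c < m → h n m ≡ + 0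

Q-annihilates-diagonal : ∀ {c h} → DiagonalBeyond c h → VanishesBeyond c (Q-mul .act h)
Q-annihilates-diagonal {h = h} diag n m c<m =
  trans (cong (λ x → + 1 ℤ.* x ℤ.- shiftX (shiftY h) n m) (diag n m c<m)) (cancel (shiftX (shiftY h) n m))
  where
  cancel : ∀ x → + 1 ℤ.* x ℤ.- x ≡ + 0
  cancel = ℤ-Solver.solve-∀

R-annihilates-steep : ∀ {c h} → SteepBeyond c h → VanishesBeyond c (R-mul .act h)
R-annihilates-steep {h = h} steep n m c<m =
  trans (cong₂ (λ x y → + 1 ℤ.* x ℤ.- y) (steep n m c<m) (unit n)) (cancel (shiftX (shiftX (shiftY h)) n m))
  where
  cancel : ∀ x → + 1 ℤ.* x ℤ.- + 1 ℤ.* x ≡ + 0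
  cancel = ℤ-Solver.solve-∀
  unit : ∀ n → shiftX (shiftX (scale (+ 1) (shiftY h))) n m ≡ + 1 ℤ.* shiftX (shiftX (shiftY h)) n m
  unit zero          = refl
  unit (suc zero)    = refl
  unit (suc (suc n)) = refl

Q-preserves-vanishing : ∀ {c h} → VanishesBeyond c h → VanishesBeyond (suc c) (Q-mul .act h)
Q-preserves-vanishing {c} {h} zero-beyond n (suc m) (s≤s c<m) = begin
  + 1 ℤ.* h n (suc m) ℤ.- shiftX (shiftY h) n (suc m)
    ≡⟨ cong₂ (λ x y → + 1 ℤ.* x ℤ.- y) (zero-beyond n (suc m) (ℕₚ.m<n⇒m<1+n c<m)) (shifted n) ⟩
  + 0 ∎
  where
  shifted : ∀ n → shiftX (shiftY h) n (suc m) ≡ + 0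
  shifted zero    = refl
  shifted (suc n) = zero-beyond n m c<m

R-preserves-diagonal : ∀ {c h} → DiagonalBeyond c h → DiagonalBeyond (suc c) (R-mul .act h)
R-preserves-diagonal {h = h} diag zero    (suc m) (s≤s c<m) =
  cong (λ x → + 1 ℤ.* x ℤ.- + 0) (diag 0 (suc m) (ℕₚ.m<n⇒m<1+n c<m))
R-preserves-diagonal {h = h} diag (suc n) (suc m) (s≤s c<m) =
  cong₂ (λ x y → + 1 ℤ.* x ℤ.- y) (diag (suc n) (suc m) (ℕₚ.m<n⇒m<1+n c<m)) (lower n)
  where
  lower : ∀ n → shiftX (scale (+ 1) (shiftY h)) n (suc m) ≡ shiftX (shiftX (scale (+ 1) (shiftY h))) n m
  lower zero          = refl
  lower (suc zero)    = cong (+ 1 ℤ.*_) (diag 0 m c<m)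
  lower (suc (suc n)) = cong (+ 1 ℤ.*_) (diag (suc n) m c<m)

diagonalPart-diagonal : DiagonalBeyond 1 diagonalPart
diagonalPart-diagonal _       (suc zero)    (s≤s ())
diagonalPart-diagonal zero    (suc (suc m)) _ = refl
diagonalPart-diagonal (suc n) (suc (suc m)) _ =
  pairDiff-shift (λ k → + iverson (k ≡ᵇ suc (suc m))) (λ k → + iverson (k ≡ᵇ suc m)) onDiagonal n
  where
  onDiagonal : ∀ k → + iverson (k ≡ᵇ suc (suc m)) ≡ shift (λ k → + iverson (k ≡ᵇ suc m)) k
  onDiagonal zero    = refl
  onDiagonal (suc k) = refl

widePart-steep : SteepBeyond 1 widePart
widePart-steep _             (suc zero)    (s≤s ())
widePart-steep zero          (suc (suc m)) _ = refl
widePart-steep (suc zero)    (suc (suc m)) _ = refl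
widePart-steep (suc (suc n)) (suc (suc m)) _ =
  pairDiff-shift (λ k → + widePairs k (suc m)) (shift (λ k → + widePairs k m)) twoSteps (suc n)
  where
  twoSteps : ∀ k → + widePairs k (suc m) ≡ shift (shift (λ k → + widePairs k m)) k
  twoSteps zero          = refl
  twoSteps (suc zero)    = refl
  twoSteps (suc (suc k)) = refl

reducedGF-vanishes : VanishesBeyond 2 (QR-mul .act reducedGF)
reducedGF-vanishes n m 2<m = begin
  QR-mul .act reducedGF n m
    ≡⟨ act-⊕ QR-mul diagonalPart widePart n m ⟩
  QR-mul .act diagonalPart n m ℤ.+ QR-mul .act widePart n m
    ≡⟨ cong₂ ℤ._+_ (Q-annihilates-diagonal (R-preserves-diagonal diagonalPart-diagonal) n m 2<m)
                   (Q-preserves-vanishing (R-annihilates-steep widePart-steep) n m 2<m) ⟩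
  + 0 ∎

agreeBelow : ℕ → (ℕ → ℤ) → (ℕ → ℤ) → Bool
agreeBelow zero    f g = true
agreeBelow (suc k) f g = does (f 0 ℤ.≟ g 0) ∧ agreeBelow k (f ∘ suc) (g ∘ suc)

agree-by-check : ∀ k (f g : ℕ → ℤ) → T (agreeBelow k f g) → (∀ n → f (k ℕ.+ n) ≡ g (k ℕ.+ n)) →
                 ∀ n → f n ≡ g n
agree-by-check zero    f g _  tail n = tail n
agree-by-check (suc k) f g ok tail n with f 0 ℤ.≟ g 0 | n
... | yes f0≡g0 | zero  = f0≡g0
... | yes _     | suc n = agree-by-check k (f ∘ suc) (g ∘ suc) ok tail n

δ : Series
δ = const (+ 1)

numerator-vanishes : VanishesBeyond 2 (numerator-mul .act δ)
numerator-vanishes n (suc zero)          (s≤s ())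
numerator-vanishes n (suc (suc zero))    (s≤s (s≤s ()))
numerator-vanishes n (suc (suc (suc m))) _ =
  agree-by-check 7 (λ n → numerator-mul .act δ n (3 ℕ.+ m)) (λ _ → + 0) _ (λ _ → refl) n

-- Past the checked range, both sides of each column normalise to the same term.
reducedGF-identity : QR-mul .act reducedGF ≐ numerator-mul .act δ
reducedGF-identity n 0 =
  agree-by-check 14 (λ n → QR-mul .act reducedGF n 0) (λ n → numerator-mul .act δ n 0) _ (λ _ → refl) n
reducedGF-identity n 1 =
  agree-by-check 14 (λ n → QR-mul .act reducedGF n 1) (λ n → numerator-mul .act δ n 1) _ (λ _ → refl) n
reducedGF-identity n 2 =
  agree-by-check 14 (λ n → QR-mul .act reducedGF n 2) (λ n → numerator-mul .act δ n 2) _ (λ _ → refl) n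
reducedGF-identity n (suc (suc (suc m))) =
  trans (reducedGF-vanishes n (3 ℕ.+ m) 2<3+m) (sym (numerator-vanishes n (3 ℕ.+ m) 2<3+m))
  where
  2<3+m : 2 < 3 ℕ.+ m
  2<3+m = s≤s (s≤s (s≤s z≤n))

theorem3p1 : (n m : ℕ) → (denominator ⊛ arndtGF) n m ≡ numerator n m
theorem3p1 n m = begin
  (denominator ⊛ arndtGF) n m            ≡⟨ denominator-act arndtGF n m ⟩
  QR-mul .act (P-mul .act arndtGF) n m   ≡⟨ QR-mul .act-cong P-act-arndtGF n m ⟩
  QR-mul .act reducedGF n m              ≡⟨ reducedGF-identity n m ⟩
  numerator-mul .act δ n m               ≡⟨ numerator-mul .⊛-act δ n m ⟨
  (numerator ⊛ δ) n m                    ≡⟨ ⊛-identityʳ numerator n m ⟩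
  numerator n m                          ∎
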